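{- Let $n\ge1$ and let $\mathcal P=\mathbb Z_2^n$ (viewed as an $n$-dimensional affine space over $\mathrm{GF}(2)$). Let $k=2m$ be even with $2<k<2^n$, and let $\mathcal B$ be the family of all $k$-element subsets of $\mathcal P$ whose elements sum to zero. Then $(\mathcal P,\mathcal B)$ is a $3$-$(2^n,k,r_3)$ design for some $r_3$, i.e. every set of three distinct elements of $\mathcal P$ is contained in the same number $r_3$ of members of $\mathcal B$. -}

module Defs where

open import Data.Bool using (Bool; true; false; _xor_; _∧_)
open import Data.Nat using (ℕ; zero; suc; _≟_)
open import Data.Vec using (Vec; []; _∷_; replicate; zipWith)
open import Data.List using (List; []; _∷_; map; _++_; filterᵇ; length; foldr)
open import Data.Bool.ListAction using (any)
open import Relation.Nullary.Decidable using (⌊_⌋)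
import Data.Vec.Properties as VecP
import Data.Bool.Properties as BoolP

Point : ℕ → Set
Point n = Vec Bool n

_⊕_ : ∀ {n} → Point n → Point n → Point n
_⊕_ = zipWith _xor_

𝟎 : ∀ {n} → Point n
𝟎 = replicate _ false

_==_ : ∀ {n} → Point n → Point n → Bool
x == y = ⌊ VecP.≡-dec BoolP._≟_ x y ⌋

allPoints : (n : ℕ) → List (Point n)
allPoints zero = [] ∷ []
allPoints (suc n) = map (false ∷_) (allPoints n) ++ map (true ∷_) (allPoints n)

-- All sublists of a list; applied to the duplicate-free list allPoints n,
-- this enumerates every subset of P exactly once.
sublists : ∀ {A : Set} → List A → List (List A)
sublists [] = [] ∷ []
sublists (x ∷ xs) = let s = sublists xs in s ++ map (x ∷_) s

sumPts : ∀ {n} → List (Point n) → Point n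
sumPts = foldr _⊕_ 𝟎

_∈ᵇ_ : ∀ {n} → Point n → List (Point n) → Bool
x ∈ᵇ B = any (x ==_) B

blocks : (n k : ℕ) → List (List (Point n))
blocks n k = filterᵇ (λ B → ⌊ length B ≟ k ⌋ ∧ (sumPts B == 𝟎)) (sublists (allPoints n))

replication3 : (n k : ℕ) → Point n → Point n → Point n → ℕ
replication3 n k x y z =
  length (filterᵇ (λ B → (x ∈ᵇ B) ∧ (y ∈ᵇ B) ∧ (z ∈ᵇ B)) (blocks n k))

-- An affine bijection v ↦ L v ⊕ t of ℤ₂ⁿ maps a k-subset with sum σ to one with sum
-- L σ ⊕ k·t, which is L σ for even k; so it permutes the blocks and preserves the number
-- r(x, y, z) of blocks through three points. If x and x′ both differ from y and z, choose a
-- linear functional φ that is 1 on u = y ⊕ x and u′ = y ⊕ x′ and 0 on y ⊕ z (possible as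
-- u, u′ ∉ {𝟎, y ⊕ z}); the transvection w ↦ w ⊕ φ(w)·(u ⊕ u′), conjugated by the translation
-- by y, fixes y and z and sends x to x′. Hence r(x, y, z) = r(x′, y, z), and since r is
-- symmetric it is constant on triples of distinct points.

module Submission where

open import Algebra.Bundles using (CommutativeMonoid; CommutativeRing)
open import Algebra.Definitions using (Involutive)
open import Algebra.Structures using (IsCommutativeMonoid)
import Algebra.Properties.CommutativeSemigroup as CommutativeSemigroupProperties
open import Data.Bool as Bool using (Bool; true; false; _xor_; _∧_; _∨_; if_then_else_)
open import Data.Bool.Properties
  using ( xor-assoc; xor-comm; xor-identityˡ; xor-identityʳ; xor-same; xor-∧-commutativeRing
        ; ∧-comm; ∧-commutativeMonoid; ∨-isCommutativeMonoid)
open import Data.Empty using (⊥-elim)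
open import Data.Fin as Fin using (Fin)
open import Data.List using (List; []; _∷_; _++_; map; length; replicate; filterᵇ)
open import Data.List.Properties using (filter-++; length-++; length-map; map-++; map-∘)
open import Data.List.Membership.Propositional using (_∈_)
open import Data.List.Membership.Propositional.Properties using (∈-map⁺; ∈-map⁻; ∈-++⁺ˡ; ∈-++⁺ʳ)
open import Data.List.Membership.Propositional.Properties.WithK using (unique∧set⇒bag)
open import Data.List.Relation.Binary.BagAndSetEquality using (∼bag⇒↭)
open import Data.List.Relation.Binary.Permutation.Propositional as ↭ using (_↭_; ↭-sym; ↭⇒↭ₛ)
import Data.List.Relation.Binary.Permutation.Propositional.Properties as ↭ₚ
open import Data.List.Relation.Binary.Permutation.Setoid.Properties using (foldr-commMonoid)
open import Data.List.Relation.Unary.All using ([])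
open import Data.List.Relation.Unary.AllPairs using ([]; _∷_)
open import Data.List.Relation.Unary.Any using (here)
open import Data.List.Relation.Unary.Unique.Propositional using (Unique)
open import Data.List.Relation.Unary.Unique.Propositional.Properties using (map⁺; ++⁺)
open import Data.Nat using (ℕ; zero; suc; _+_; _*_; _^_; _≤_; _<_; _≟_)
open import Data.Nat.Properties using (+-identityʳ; +-commutativeSemigroup; <-asym)
open import Data.Product using (_×_; _,_; ∃-syntax)
open import Data.Vec using ([]; _∷_; lookup; tail)
open import Data.Vec.Properties
  using (≡-dec; zipWith-assoc; zipWith-comm; zipWith-identityˡ; zipWith-identityʳ; lookup-zipWith)
open import Function using (_∘_)
open import Function.Bundles using (_⇔_; mk⇔)
open import Function.Definitions using (Injective)
open import Relation.Binary.Core using (_Preserves_⟶_)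
open import Relation.Binary.Definitions using (DecidableEquality)
open import Relation.Binary.PropositionalEquality
open import Relation.Nullary using (¬_)
open import Relation.Nullary.Decidable using (T?; ⌊_⌋; yes; no; does; isYes; isYes≗does; does-⇔)

open import Defs

open CommutativeSemigroupProperties (CommutativeRing.+-commutativeSemigroup xor-∧-commutativeRing)
  using () renaming (interchange to xor-interchange)
open CommutativeSemigroupProperties (CommutativeMonoid.commutativeSemigroup ∧-commutativeMonoid)
  using () renaming (x∙yz≈y∙xz to ∧-x∙yz≈y∙xz)
open CommutativeSemigroupProperties +-commutativeSemigroup
  using () renaming (interchange to +-interchange)

-- Symmetric functions of three distinct arguments

Distinct : ∀ {A : Set} → A → A → A → Set
Distinct x y z = x ≢ y × x ≢ z × y ≢ z

module _ {A B : Set} (_≟ᴬ_ : DecidableEquality A) (F : A → A → A → B)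
  (F-swap₁₂ : ∀ x y z → F x y z ≡ F y x z)
  (F-swap₂₃ : ∀ x y z → F x y z ≡ F x z y)
  (F-replace₁ : ∀ {x x′ y z} → x ≢ y → x ≢ z → x′ ≢ y → x′ ≢ z → F x y z ≡ F x′ y z)
  where

  private
    F-replace₂ : ∀ {x y y′ z} → y ≢ x → y ≢ z → y′ ≢ x → y′ ≢ z → F x y z ≡ F x y′ z
    F-replace₂ {x} {y} {y′} {z} y≢x y≢z y′≢x y′≢z = begin
      F x y z   ≡⟨ F-swap₁₂ x y z ⟩
      F y x z   ≡⟨ F-replace₁ y≢x y≢z y′≢x y′≢z ⟩
      F y′ x z  ≡⟨ F-swap₁₂ y′ x z ⟩
      F x y′ z  ∎
      where open ≡-Reasoning

    F-replace₃ : ∀ {x y z z′} → z ≢ x → z ≢ y → z′ ≢ x → z′ ≢ y → F x y z ≡ F x y z′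
    F-replace₃ {x} {y} {z} {z′} z≢x z≢y z′≢x z′≢y = begin
      F x y z   ≡⟨ F-swap₂₃ x y z ⟩
      F x z y   ≡⟨ F-replace₂ z≢x z≢y z′≢x z′≢y ⟩
      F x z′ y  ≡⟨ F-swap₂₃ x z′ y ⟩
      F x y z′  ∎
      where open ≡-Reasoning

    move-to-first : ∀ a {x y z} → Distinct x y z →
      ∃[ y′ ] ∃[ z′ ] (Distinct a y′ z′ × F x y z ≡ F a y′ z′)
    move-to-first a {x} {y} {z} (x≢y , x≢z , y≢z) with a ≟ᴬ y | a ≟ᴬ z
    ... | yes refl | _        = x , z , (≢-sym x≢y , y≢z , x≢z) , F-swap₁₂ x y z
    ... | no _     | yes refl = x , y , (≢-sym x≢z , ≢-sym y≢z , x≢y) ,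
                                trans (F-swap₂₃ x y z) (F-swap₁₂ x z y)
    ... | no a≢y   | no a≢z   = y , z , (a≢y , a≢z , y≢z) , F-replace₁ x≢y x≢z a≢y a≢z

    move-to-second : ∀ {a} b {y z} → a ≢ b → Distinct a y z →
      ∃[ z′ ] (Distinct a b z′ × F a y z ≡ F a b z′)
    move-to-second {a} b {y} {z} a≢b (a≢y , a≢z , y≢z) with b ≟ᴬ z
    ... | yes refl = y , (a≢z , a≢y , ≢-sym y≢z) , F-swap₂₃ a y z
    ... | no b≢z   = z , (a≢b , a≢z , b≢z) , F-replace₂ (≢-sym a≢y) y≢z (≢-sym a≢b) b≢z

  constant-on-distinct : ∀ {x y z a b c} → Distinct x y z → Distinct a b c → F x y z ≡ F a b c
  constant-on-distinct {x} {y} {z} {a} {b} {c} xyz (a≢b , a≢c , b≢c) with move-to-first a xyz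
  ... | y′ , z′ , ay′z′ , xyz≡ay′z′ with move-to-second b a≢b ay′z′
  ... | z″ , (_ , a≢z″ , b≢z″) , ay′z′≡abz″ = begin
    F x y z    ≡⟨ xyz≡ay′z′ ⟩
    F a y′ z′  ≡⟨ ay′z′≡abz″ ⟩
    F a b z″   ≡⟨ F-replace₃ (≢-sym a≢z″) (≢-sym b≢z″) (≢-sym a≢c) (≢-sym b≢c) ⟩
    F a b c    ∎
    where open ≡-Reasoning

module _ {n : ℕ} where

  ⊕-assoc : (u v w : Point n) → (u ⊕ v) ⊕ w ≡ u ⊕ (v ⊕ w)
  ⊕-assoc = zipWith-assoc xor-assoc

  ⊕-comm : (v w : Point n) → v ⊕ w ≡ w ⊕ v
  ⊕-comm = zipWith-comm xor-comm

  ⊕-identityˡ : (v : Point n) → 𝟎 ⊕ v ≡ v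
  ⊕-identityˡ = zipWith-identityˡ xor-identityˡ

  ⊕-identityʳ : (v : Point n) → v ⊕ 𝟎 ≡ v
  ⊕-identityʳ = zipWith-identityʳ xor-identityʳ

  ⊕-isCommutativeMonoid : IsCommutativeMonoid _≡_ _⊕_ 𝟎
  ⊕-isCommutativeMonoid = record
    { isMonoid = record
      { isSemigroup = record { isMagma = isMagma _⊕_ ; assoc = ⊕-assoc }
      ; identity    = ⊕-identityˡ , ⊕-identityʳ
      }
    ; comm = ⊕-comm
    }

⊕-self : ∀ {n} (v : Point n) → v ⊕ v ≡ 𝟎
⊕-self []      = refl
⊕-self (b ∷ v) = cong₂ _∷_ (xor-same b) (⊕-self v)

⊕-interchange : ∀ {n} (t u v w : Point n) → (t ⊕ u) ⊕ (v ⊕ w) ≡ (t ⊕ v) ⊕ (u ⊕ w)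
⊕-interchange []      []      []      []      = refl
⊕-interchange (a ∷ t) (b ∷ u) (c ∷ v) (d ∷ w) =
  cong₂ _∷_ (xor-interchange a b c d) (⊕-interchange t u v w)

⊕-involutiveˡ : ∀ {n} (t v : Point n) → t ⊕ (t ⊕ v) ≡ v
⊕-involutiveˡ t v = begin
  t ⊕ (t ⊕ v)  ≡⟨ ⊕-assoc t t v ⟨
  (t ⊕ t) ⊕ v  ≡⟨ cong (_⊕ v) (⊕-self t) ⟩
  𝟎 ⊕ v        ≡⟨ ⊕-identityˡ v ⟩
  v            ∎
  where open ≡-Reasoning

⊕-involutiveʳ : ∀ {n} (v t : Point n) → (v ⊕ t) ⊕ t ≡ v
⊕-involutiveʳ v t = begin
  (v ⊕ t) ⊕ t  ≡⟨ ⊕-assoc v t t ⟩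
  v ⊕ (t ⊕ t)  ≡⟨ cong (v ⊕_) (⊕-self t) ⟩
  v ⊕ 𝟎        ≡⟨ ⊕-identityʳ v ⟩
  v            ∎
  where open ≡-Reasoning

⊕-cancelˡ : ∀ {n} (t : Point n) {v w : Point n} → t ⊕ v ≡ t ⊕ w → v ≡ w
⊕-cancelˡ t {v} {w} eq = trans (sym (⊕-involutiveˡ t v)) (trans (cong (t ⊕_) eq) (⊕-involutiveˡ t w))

⊕≡𝟎⇒≡ : ∀ {n} {v w : Point n} → v ⊕ w ≡ 𝟎 → v ≡ w
⊕≡𝟎⇒≡ {v = v} eq = sym (⊕-cancelˡ v (trans eq (sym (⊕-self v))))

Additive : ∀ {n} → (Point n → Point n) → Set
Additive L = ∀ v w → L (v ⊕ w) ≡ L v ⊕ L w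

additive-𝟎 : ∀ {n} {L : Point n → Point n} → Additive L → L 𝟎 ≡ 𝟎
additive-𝟎 {L = L} L-additive = begin
  L 𝟎        ≡⟨ cong L (⊕-self 𝟎) ⟨
  L (𝟎 ⊕ 𝟎)  ≡⟨ L-additive 𝟎 𝟎 ⟩
  L 𝟎 ⊕ L 𝟎  ≡⟨ ⊕-self (L 𝟎) ⟩
  𝟎          ∎
  where open ≡-Reasoning

additive-involution-zero⇔ : ∀ {n} {L : Point n → Point n} → Additive L → Involutive _≡_ L →
  ∀ v → L v ≡ 𝟎 ⇔ v ≡ 𝟎
additive-involution-zero⇔ {L = L} L-additive L-involutive v = mk⇔ Lv≡𝟎⇒v≡𝟎 (λ v≡𝟎 → trans (cong L v≡𝟎) L𝟎≡𝟎)
  where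
  open ≡-Reasoning
  L𝟎≡𝟎 = additive-𝟎 L-additive
  Lv≡𝟎⇒v≡𝟎 : L v ≡ 𝟎 → v ≡ 𝟎
  Lv≡𝟎⇒v≡𝟎 Lv≡𝟎 = begin
    v        ≡⟨ L-involutive v ⟨
    L (L v)  ≡⟨ cong L Lv≡𝟎 ⟩
    L 𝟎      ≡⟨ L𝟎≡𝟎 ⟩
    𝟎        ∎

sumPts-↭ : ∀ {n} {S S′ : List (Point n)} → S ↭ S′ → sumPts S ≡ sumPts S′
sumPts-↭ {n} S↭S′ = foldr-commMonoid (setoid (Point n)) ⊕-isCommutativeMonoid (↭⇒↭ₛ S↭S′)

sumPts-map-additive : ∀ {n} {L : Point n → Point n} → Additive L →
  ∀ S → sumPts (map L S) ≡ L (sumPts S)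
sumPts-map-additive L-additive []      = sym (additive-𝟎 L-additive)
sumPts-map-additive {L = L} L-additive (s ∷ S) =
  trans (cong (L s ⊕_) (sumPts-map-additive L-additive S)) (sym (L-additive s (sumPts S)))

sumPts-map-translate : ∀ {n} (t : Point n) S →
  sumPts (map (t ⊕_) S) ≡ sumPts (replicate (length S) t) ⊕ sumPts S
sumPts-map-translate t []      = sym (⊕-identityˡ 𝟎)
sumPts-map-translate t (s ∷ S) = begin
  (t ⊕ s) ⊕ sumPts (map (t ⊕_) S)  ≡⟨ cong ((t ⊕ s) ⊕_) (sumPts-map-translate t S) ⟩
  (t ⊕ s) ⊕ (tˢ ⊕ sumPts S)        ≡⟨ ⊕-interchange t s tˢ (sumPts S) ⟩
  (t ⊕ tˢ) ⊕ (s ⊕ sumPts S)        ∎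
  where
  open ≡-Reasoning
  tˢ = sumPts (replicate (length S) t)

sumPts-replicate-+ : ∀ {n} i j (t : Point n) →
  sumPts (replicate (i + j) t) ≡ sumPts (replicate i t) ⊕ sumPts (replicate j t)
sumPts-replicate-+ zero    j t = sym (⊕-identityˡ _)
sumPts-replicate-+ (suc i) j t =
  trans (cong (t ⊕_) (sumPts-replicate-+ i j t)) (sym (⊕-assoc t _ _))

sumPts-replicate-even : ∀ {n} m (t : Point n) → sumPts (replicate (2 * m) t) ≡ 𝟎
sumPts-replicate-even m t = begin
  sumPts (replicate (m + (m + 0)) t)               ≡⟨ cong (λ j → sumPts (replicate (m + j) t)) (+-identityʳ m) ⟩
  sumPts (replicate (m + m) t)                     ≡⟨ sumPts-replicate-+ m m t ⟩
  sumPts (replicate m t) ⊕ sumPts (replicate m t)  ≡⟨ ⊕-self _ ⟩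
  𝟎                                                ∎
  where open ≡-Reasoning

sumPts-map-translate-even : ∀ {n} m (t : Point n) S → length S ≡ 2 * m →
  sumPts (map (t ⊕_) S) ≡ sumPts S
sumPts-map-translate-even m t S |S|≡2m = begin
  sumPts (map (t ⊕_) S)                       ≡⟨ sumPts-map-translate t S ⟩
  sumPts (replicate (length S) t) ⊕ sumPts S  ≡⟨ cong (λ l → sumPts (replicate l t) ⊕ sumPts S) |S|≡2m ⟩
  sumPts (replicate (2 * m) t) ⊕ sumPts S     ≡⟨ cong (_⊕ sumPts S) (sumPts-replicate-even m t) ⟩
  𝟎 ⊕ sumPts S                                ≡⟨ ⊕-identityˡ (sumPts S) ⟩
  sumPts S                                    ∎
  where open ≡-Reasoning

-- Linear functionals and transvections

Linear : ∀ {n} → (Point n → Bool) → Set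
Linear φ = ∀ v w → φ (v ⊕ w) ≡ φ v xor φ w

linear-xor : ∀ {n} (φ ψ : Point n → Bool) → Linear φ → Linear ψ → Linear (λ v → φ v xor ψ v)
linear-xor φ ψ φ-linear ψ-linear v w =
  trans (cong₂ _xor_ (φ-linear v w) (ψ-linear v w)) (xor-interchange (φ v) (φ w) (ψ v) (ψ w))

lookup-linear : ∀ {n} (i : Fin n) → Linear (λ v → lookup v i)
lookup-linear i = lookup-zipWith _xor_ i

nonzero-coordinate : ∀ {n} (v : Point n) → v ≢ 𝟎 → ∃[ i ] lookup v i ≡ true
nonzero-coordinate []          v≢𝟎 = ⊥-elim (v≢𝟎 refl)
nonzero-coordinate (true ∷ v)  v≢𝟎 = Fin.zero , refl
nonzero-coordinate (false ∷ v) v≢𝟎 with nonzero-coordinate v (v≢𝟎 ∘ cong (false ∷_))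
... | i , vᵢ≡true = Fin.suc i , vᵢ≡true

detecting : ∀ {n} (v : Point n) → v ≢ 𝟎 → ∃[ φ ] (Linear φ × φ v ≡ true)
detecting v v≢𝟎 with nonzero-coordinate v v≢𝟎
... | i , vᵢ≡true = (λ w → lookup w i) , lookup-linear i , vᵢ≡true

separating : ∀ {n} (v w : Point n) → v ≢ 𝟎 → v ≢ w →
  ∃[ φ ] (Linear φ × φ v ≡ true × φ w ≡ false)
separating v w v≢𝟎 v≢w
  with detecting v v≢𝟎 | detecting (v ⊕ w) (v≢w ∘ ⊕≡𝟎⇒≡)
... | φ , φ-linear , φv | ψ , ψ-linear , ψ[v⊕w]
  with φ w in φw | ψ v in ψv | ψ w in ψw | trans (sym (ψ-linear v w)) ψ[v⊕w]
... | false | _     | _     | _  = φ , φ-linear , φv , φw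
... | true  | true  | false | _  = ψ , ψ-linear , ψv , ψw
... | true  | false | true  | _  =
  (λ u → φ u xor ψ u) , linear-xor φ ψ φ-linear ψ-linear , cong₂ _xor_ φv ψv , cong₂ _xor_ φw ψw
... | true  | true  | true  | ()
... | true  | false | false | ()

separating₂ : ∀ {n} (u u′ d : Point n) → u ≢ 𝟎 → u′ ≢ 𝟎 → u ≢ d → u′ ≢ d →
  ∃[ φ ] (Linear φ × φ u ≡ true × φ u′ ≡ true × φ d ≡ false)
separating₂ u u′ d u≢𝟎 u′≢𝟎 u≢d u′≢d
  with separating u d u≢𝟎 u≢d | separating u′ d u′≢𝟎 u′≢d
... | φ , φ-linear , φu , φd | ψ , ψ-linear , ψu′ , ψd
  with φ u′ in φu′ | ψ u in ψu
... | true  | _     = φ , φ-linear , φu , φu′ , φd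
... | false | true  = ψ , ψ-linear , ψu , ψu′ , ψd
... | false | false =
  (λ v → φ v xor ψ v) , linear-xor φ ψ φ-linear ψ-linear ,
  cong₂ _xor_ φu ψu , cong₂ _xor_ φu′ ψu′ , cong₂ _xor_ φd ψd

infixr 30 _·_

_·_ : ∀ {n} → Bool → Point n → Point n
b · a = if b then a else 𝟎

·-distribʳ-xor : ∀ {n} (p q : Bool) (a : Point n) → (p xor q) · a ≡ p · a ⊕ q · a
·-distribʳ-xor true  true  a = sym (⊕-self a)
·-distribʳ-xor true  false a = sym (⊕-identityʳ a)
·-distribʳ-xor false q     a = sym (⊕-identityˡ (q · a))

transvection : ∀ {n} → (Point n → Bool) → Point n → Point n → Point n
transvection φ a v = v ⊕ φ v · a

module _ {n} (φ : Point n → Bool) (a : Point n) where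

  transvection-fixes : ∀ {v} → φ v ≡ false → transvection φ a v ≡ v
  transvection-fixes {v} φv = trans (cong (λ b → v ⊕ b · a) φv) (⊕-identityʳ v)

  transvection-moves : ∀ {v} → φ v ≡ true → transvection φ a v ≡ v ⊕ a
  transvection-moves {v} φv = cong (λ b → v ⊕ b · a) φv

  transvection-additive : Linear φ → Additive (transvection φ a)
  transvection-additive φ-linear v w = begin
    (v ⊕ w) ⊕ φ (v ⊕ w) · a        ≡⟨ cong (λ b → (v ⊕ w) ⊕ b · a) (φ-linear v w) ⟩
    (v ⊕ w) ⊕ (φ v xor φ w) · a    ≡⟨ cong ((v ⊕ w) ⊕_) (·-distribʳ-xor (φ v) (φ w) a) ⟩
    (v ⊕ w) ⊕ (φ v · a ⊕ φ w · a)  ≡⟨ ⊕-interchange v w (φ v · a) (φ w · a) ⟩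
    (v ⊕ φ v · a) ⊕ (w ⊕ φ w · a)  ∎
    where open ≡-Reasoning

  transvection-involutive : Linear φ → φ a ≡ false → Involutive _≡_ (transvection φ a)
  transvection-involutive φ-linear φa v = by-cases (φ v) refl
    where
    open ≡-Reasoning
    by-cases : ∀ b → φ v ≡ b → transvection φ a (transvection φ a v) ≡ v
    by-cases false φv =
      trans (cong (transvection φ a) (transvection-fixes φv)) (transvection-fixes φv)
    by-cases true φv = begin
      transvection φ a (transvection φ a v)  ≡⟨ cong (transvection φ a) (transvection-moves φv) ⟩
      transvection φ a (v ⊕ a)               ≡⟨ transvection-moves (trans (φ-linear v a) (cong₂ _xor_ φv φa)) ⟩
      (v ⊕ a) ⊕ a                            ≡⟨ ⊕-involutiveʳ v a ⟩
      v                                      ∎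

-- Counting sublists

module _ {A : Set} where

  countᵇ : (A → Bool) → List A → ℕ
  countᵇ p xs = length (filterᵇ p xs)

  countᵇ-++ : ∀ p (xs ys : List A) → countᵇ p (xs ++ ys) ≡ countᵇ p xs + countᵇ p ys
  countᵇ-++ p xs ys = trans (cong length (filter-++ (T? ∘ p) xs ys)) (length-++ (filterᵇ p xs))

  countᵇ-cong : ∀ {p q : A → Bool} → p ≗ q → countᵇ p ≗ countᵇ q
  countᵇ-cong p≗q []       = refl
  countᵇ-cong {p} {q} p≗q (x ∷ xs) rewrite p≗q x with q x
  ... | true  = cong suc (countᵇ-cong p≗q xs)
  ... | false = countᵇ-cong p≗q xs

  countᵇ-filterᵇ : ∀ (p q : A → Bool) xs →
    length (filterᵇ p (filterᵇ q xs)) ≡ countᵇ (λ x → q x ∧ p x) xs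
  countᵇ-filterᵇ p q []       = refl
  countᵇ-filterᵇ p q (x ∷ xs) with q x
  ... | false = countᵇ-filterᵇ p q xs
  ... | true with p x
  ...   | true  = cong suc (countᵇ-filterᵇ p q xs)
  ...   | false = countᵇ-filterᵇ p q xs

countᵇ-map : ∀ {A B : Set} (p : B → Bool) (f : A → B) xs → countᵇ p (map f xs) ≡ countᵇ (p ∘ f) xs
countᵇ-map p f []       = refl
countᵇ-map p f (x ∷ xs) with p (f x)
... | true  = cong suc (countᵇ-map p f xs)
... | false = countᵇ-map p f xs

module _ {A : Set} where

  countᵇ-sublists-∷ : ∀ (p : List A → Bool) x xs →
    countᵇ p (sublists (x ∷ xs)) ≡ countᵇ p (sublists xs) + countᵇ (p ∘ (x ∷_)) (sublists xs)
  countᵇ-sublists-∷ p x xs =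
    trans (countᵇ-++ p (sublists xs) _) (cong (countᵇ p (sublists xs) +_) (countᵇ-map p (x ∷_) (sublists xs)))

  countᵇ-sublists-∷∷ : ∀ (p : List A → Bool) x y xs →
    countᵇ p (sublists (x ∷ y ∷ xs)) ≡
      (countᵇ p (sublists xs) + countᵇ (p ∘ (y ∷_)) (sublists xs)) +
      (countᵇ (p ∘ (x ∷_)) (sublists xs) + countᵇ (p ∘ (x ∷_) ∘ (y ∷_)) (sublists xs))
  countᵇ-sublists-∷∷ p x y xs =
    trans (countᵇ-sublists-∷ p x (y ∷ xs))
          (cong₂ _+_ (countᵇ-sublists-∷ p y xs) (countᵇ-sublists-∷ (p ∘ (x ∷_)) y xs))

  countᵇ-sublists-↭ : ∀ (p : List A → Bool) → p Preserves _↭_ ⟶ _≡_ →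
    ∀ {xs ys} → xs ↭ ys → countᵇ p (sublists xs) ≡ countᵇ p (sublists ys)
  countᵇ-sublists-↭ p p-↭ ↭.refl = refl
  countᵇ-sublists-↭ p p-↭ (↭.trans xs↭ys ys↭zs) =
    trans (countᵇ-sublists-↭ p p-↭ xs↭ys) (countᵇ-sublists-↭ p p-↭ ys↭zs)
  countᵇ-sublists-↭ p p-↭ {x ∷ xs} {x ∷ ys} (↭.prep x xs↭ys) = begin
    c p (x ∷ xs)                ≡⟨ countᵇ-sublists-∷ p x xs ⟩
    c p xs + c (p ∘ (x ∷_)) xs  ≡⟨ cong₂ _+_ (countᵇ-sublists-↭ p p-↭ xs↭ys)
                                             (countᵇ-sublists-↭ (p ∘ (x ∷_)) (p-↭ ∘ ↭.prep x) xs↭ys) ⟩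
    c p ys + c (p ∘ (x ∷_)) ys  ≡⟨ countᵇ-sublists-∷ p x ys ⟨
    c p (x ∷ ys)                ∎
    where
    open ≡-Reasoning
    c : (List A → Bool) → List A → ℕ
    c q zs = countᵇ q (sublists zs)
  countᵇ-sublists-↭ p p-↭ {x ∷ y ∷ xs} {y ∷ x ∷ ys} (↭.swap x y xs↭ys) = begin
    c p (x ∷ y ∷ xs)
      ≡⟨ countᵇ-sublists-∷∷ p x y xs ⟩
    (c p xs + c (p ∘ (y ∷_)) xs) + (c (p ∘ (x ∷_)) xs + c (p ∘ (x ∷_) ∘ (y ∷_)) xs)
      ≡⟨ cong₂ _+_ (cong₂ _+_ (IH p p-↭) (IH (p ∘ (y ∷_)) (p-↭ ∘ ↭.prep y)))
                   (cong₂ _+_ (IH (p ∘ (x ∷_)) (p-↭ ∘ ↭.prep x))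
                              (trans (IH (p ∘ (x ∷_) ∘ (y ∷_)) (p-↭ ∘ ↭.prep x ∘ ↭.prep y))
                                     (countᵇ-cong (λ _ → p-↭ (↭.swap x y ↭.refl)) (sublists ys)))) ⟩
    (c p ys + c (p ∘ (y ∷_)) ys) + (c (p ∘ (x ∷_)) ys + c (p ∘ (y ∷_) ∘ (x ∷_)) ys)
      ≡⟨ +-interchange (c p ys) _ _ _ ⟩
    (c p ys + c (p ∘ (x ∷_)) ys) + (c (p ∘ (y ∷_)) ys + c (p ∘ (y ∷_) ∘ (x ∷_)) ys)
      ≡⟨ countᵇ-sublists-∷∷ p y x ys ⟨
    c p (y ∷ x ∷ ys)
      ∎
    where
    open ≡-Reasoning
    c : (List A → Bool) → List A → ℕ
    c q zs = countᵇ q (sublists zs)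
    IH : ∀ q → q Preserves _↭_ ⟶ _≡_ → c q xs ≡ c q ys
    IH q q-↭ = countᵇ-sublists-↭ q q-↭ xs↭ys

sublists-map : ∀ {A B : Set} (f : A → B) xs → sublists (map f xs) ≡ map (map f) (sublists xs)
sublists-map f []       = refl
sublists-map f (x ∷ xs) = begin
  sublists (map f xs) ++ map (f x ∷_) (sublists (map f xs))  ≡⟨ cong (λ s → s ++ map (f x ∷_) s) (sublists-map f xs) ⟩
  ss ++ map (f x ∷_) ss                                      ≡⟨ cong (ss ++_) (map-∘ (sublists xs)) ⟨
  ss ++ map (map f ∘ (x ∷_)) (sublists xs)                   ≡⟨ cong (ss ++_) (map-∘ (sublists xs)) ⟩
  ss ++ map (map f) (map (x ∷_) (sublists xs))               ≡⟨ map-++ (map f) (sublists xs) _ ⟨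
  map (map f) (sublists xs ++ map (x ∷_) (sublists xs))      ∎
  where
  open ≡-Reasoning
  ss = map (map f) (sublists xs)

involutive⇒injective : ∀ {A : Set} {f : A → A} → Involutive _≡_ f → Injective _≡_ _≡_ f
involutive⇒injective {f = f} f-involutive {x} {y} fx≡fy =
  trans (sym (f-involutive x)) (trans (cong f fx≡fy) (f-involutive y))

allPoints-complete : ∀ {n} (v : Point n) → v ∈ allPoints n
allPoints-complete []                  = here refl
allPoints-complete {suc n} (false ∷ v) = ∈-++⁺ˡ (∈-map⁺ (false ∷_) (allPoints-complete v))
allPoints-complete {suc n} (true ∷ v)  =
  ∈-++⁺ʳ (map (false ∷_) (allPoints n)) (∈-map⁺ (true ∷_) (allPoints-complete v))

allPoints-unique : ∀ n → Unique (allPoints n)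
allPoints-unique zero    = [] ∷ []
allPoints-unique (suc n) =
  ++⁺ (map⁺ (cong tail) (allPoints-unique n)) (map⁺ (cong tail) (allPoints-unique n)) disjoint
  where
  disjoint : ∀ {v} → ¬ (v ∈ map (false ∷_) (allPoints n) × v ∈ map (true ∷_) (allPoints n))
  disjoint (v∈false∷ , v∈true∷) with ∈-map⁻ (false ∷_) v∈false∷ | ∈-map⁻ (true ∷_) v∈true∷
  ... | _ , _ , refl | _ , _ , ()

map-allPoints-↭ : ∀ {n} {f : Point n → Point n} → Involutive _≡_ f → map f (allPoints n) ↭ allPoints n
map-allPoints-↭ {n} {f} f-involutive = ∼bag⇒↭ (unique∧set⇒bag
  (map⁺ (involutive⇒injective f-involutive) (allPoints-unique n)) (allPoints-unique n)
  (λ {v} → mk⇔ (λ _ → allPoints-complete v)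
                (λ _ → subst (_∈ map f (allPoints n)) (f-involutive v) (∈-map⁺ f (allPoints-complete (f v))))))

-- The replication number

==-cong-⇔ : ∀ {n} {a b c d : Point n} → (a ≡ b ⇔ c ≡ d) → (a == b) ≡ (c == d)
==-cong-⇔ {a = a} {b} {c} {d} a≡b⇔c≡d = begin
  isYes (a ≟ᴾ b)  ≡⟨ isYes≗does (a ≟ᴾ b) ⟩
  does (a ≟ᴾ b)   ≡⟨ does-⇔ a≡b⇔c≡d (a ≟ᴾ b) (c ≟ᴾ d) ⟩
  does (c ≟ᴾ d)   ≡⟨ isYes≗does (c ≟ᴾ d) ⟨
  isYes (c ≟ᴾ d)  ∎
  where
  open ≡-Reasoning
  _≟ᴾ_ = ≡-dec Bool._≟_

∈ᵇ-↭ : ∀ {n} (x : Point n) {S S′} → S ↭ S′ → (x ∈ᵇ S) ≡ (x ∈ᵇ S′)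
∈ᵇ-↭ x S↭S′ = foldr-commMonoid (setoid Bool) ∨-isCommutativeMonoid (↭⇒↭ₛ (↭ₚ.map⁺ (x ==_) S↭S′))

∈ᵇ-map : ∀ {n} {f : Point n → Point n} → Injective _≡_ _≡_ f →
  ∀ x S → (f x ∈ᵇ map f S) ≡ (x ∈ᵇ S)
∈ᵇ-map f-injective x []      = refl
∈ᵇ-map {f = f} f-injective x (s ∷ S) =
  cong₂ _∨_ (==-cong-⇔ (mk⇔ f-injective (cong f))) (∈ᵇ-map f-injective x S)

module _ {n : ℕ} (k : ℕ) where

  isBlock : List (Point n) → Bool
  isBlock S = ⌊ length S ≟ k ⌋ ∧ (sumPts S == 𝟎)

  blockThrough : Point n → Point n → Point n → List (Point n) → Bool
  blockThrough x y z S = isBlock S ∧ ((x ∈ᵇ S) ∧ (y ∈ᵇ S) ∧ (z ∈ᵇ S))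

  ZeroSumPreserving : (Point n → Point n) → Set
  ZeroSumPreserving f = ∀ S → length S ≡ k → (sumPts (map f S) ≡ 𝟎 ⇔ sumPts S ≡ 𝟎)

  replication3-countᵇ : ∀ x y z →
    replication3 n k x y z ≡ countᵇ (blockThrough x y z) (sublists (allPoints n))
  replication3-countᵇ x y z = countᵇ-filterᵇ _ _ (sublists (allPoints n))

  blockThrough-↭ : ∀ x y z → blockThrough x y z Preserves _↭_ ⟶ _≡_
  blockThrough-↭ x y z S↭S′
    rewrite ↭ₚ.↭-length S↭S′ | sumPts-↭ S↭S′ | ∈ᵇ-↭ x S↭S′ | ∈ᵇ-↭ y S↭S′ | ∈ᵇ-↭ z S↭S′ = refl

  isBlock-map : ∀ {f} → ZeroSumPreserving f → ∀ S → isBlock (map f S) ≡ isBlock S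
  isBlock-map {f} f-preserving S rewrite length-map f S with length S ≟ k
  ... | yes |S|≡k = ==-cong-⇔ (f-preserving S |S|≡k)
  ... | no  _     = refl

  blockThrough-map : ∀ {f} → Injective _≡_ _≡_ f → ZeroSumPreserving f →
    ∀ x y z S → blockThrough (f x) (f y) (f z) (map f S) ≡ blockThrough x y z S
  blockThrough-map f-injective f-preserving x y z S
    rewrite isBlock-map f-preserving S
          | ∈ᵇ-map f-injective x S | ∈ᵇ-map f-injective y S | ∈ᵇ-map f-injective z S = refl

  replication3-invariant : ∀ {f} → Involutive _≡_ f → ZeroSumPreserving f →
    ∀ x y z → replication3 n k (f x) (f y) (f z) ≡ replication3 n k x y z
  replication3-invariant {f} f-involutive f-preserving x y z = begin
    replication3 n k (f x) (f y) (f z)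
      ≡⟨ replication3-countᵇ (f x) (f y) (f z) ⟩
    countᵇ p (sublists (allPoints n))
      ≡⟨ countᵇ-sublists-↭ p (blockThrough-↭ (f x) (f y) (f z)) (↭-sym (map-allPoints-↭ f-involutive)) ⟩
    countᵇ p (sublists (map f (allPoints n)))
      ≡⟨ cong (countᵇ p) (sublists-map f (allPoints n)) ⟩
    countᵇ p (map (map f) (sublists (allPoints n)))
      ≡⟨ countᵇ-map p (map f) (sublists (allPoints n)) ⟩
    countᵇ (p ∘ map f) (sublists (allPoints n))
      ≡⟨ countᵇ-cong (blockThrough-map (involutive⇒injective f-involutive) f-preserving x y z)
                     (sublists (allPoints n)) ⟩
    countᵇ (blockThrough x y z) (sublists (allPoints n))
      ≡⟨ replication3-countᵇ x y z ⟨
    replication3 n k x y z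
      ∎
    where
    open ≡-Reasoning
    p = blockThrough (f x) (f y) (f z)

  replication3-swap₁₂ : ∀ x y z → replication3 n k x y z ≡ replication3 n k y x z
  replication3-swap₁₂ x y z = begin
    replication3 n k x y z
      ≡⟨ replication3-countᵇ x y z ⟩
    countᵇ (blockThrough x y z) (sublists (allPoints n))
      ≡⟨ countᵇ-cong (λ S → cong (isBlock S ∧_) (∧-x∙yz≈y∙xz (x ∈ᵇ S) (y ∈ᵇ S) (z ∈ᵇ S)))
                     (sublists (allPoints n)) ⟩
    countᵇ (blockThrough y x z) (sublists (allPoints n))
      ≡⟨ replication3-countᵇ y x z ⟨
    replication3 n k y x z
      ∎
    where open ≡-Reasoning

  replication3-swap₂₃ : ∀ x y z → replication3 n k x y z ≡ replication3 n k x z y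
  replication3-swap₂₃ x y z = begin
    replication3 n k x y z
      ≡⟨ replication3-countᵇ x y z ⟩
    countᵇ (blockThrough x y z) (sublists (allPoints n))
      ≡⟨ countᵇ-cong (λ S → cong (λ b → isBlock S ∧ ((x ∈ᵇ S) ∧ b)) (∧-comm (y ∈ᵇ S) (z ∈ᵇ S)))
                     (sublists (allPoints n)) ⟩
    countᵇ (blockThrough x z y) (sublists (allPoints n))
      ≡⟨ replication3-countᵇ x z y ⟨
    replication3 n k x z y
      ∎
    where open ≡-Reasoning

translation-zeroSumPreserving : ∀ {n} m (t : Point n) → ZeroSumPreserving (2 * m) (t ⊕_)
translation-zeroSumPreserving m t S |S|≡2m = mk⇔ (trans (sym sums≡)) (trans sums≡)
  where sums≡ = sumPts-map-translate-even m t S |S|≡2m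

additive-involution-zeroSumPreserving : ∀ {n} k {L : Point n → Point n} →
  Additive L → Involutive _≡_ L → ZeroSumPreserving k L
additive-involution-zeroSumPreserving k L-additive L-involutive S _ =
  subst (λ σ → σ ≡ 𝟎 ⇔ sumPts S ≡ 𝟎) (sym (sumPts-map-additive L-additive S))
        (additive-involution-zero⇔ L-additive L-involutive (sumPts S))

module _ {n : ℕ} (m : ℕ) where

  private
    R : Point n → Point n → Point n → ℕ
    R = replication3 n (2 * m)

    translation-invariant : ∀ t x y z → R (t ⊕ x) (t ⊕ y) (t ⊕ z) ≡ R x y z
    translation-invariant t =
      replication3-invariant (2 * m) (⊕-involutiveˡ t) (translation-zeroSumPreserving m t)

  replication3-replace₁ : ∀ {x x′ y z} → x ≢ y → x ≢ z → x′ ≢ y → x′ ≢ z → R x y z ≡ R x′ y z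
  replication3-replace₁ {x} {x′} {y} {z} x≢y x≢z x′≢y x′≢z
    with separating₂ (y ⊕ x) (y ⊕ x′) (y ⊕ z)
           (x≢y ∘ sym ∘ ⊕≡𝟎⇒≡) (x′≢y ∘ sym ∘ ⊕≡𝟎⇒≡) (x≢z ∘ ⊕-cancelˡ y) (x′≢z ∘ ⊕-cancelˡ y)
  ... | φ , φ-linear , φu , φu′ , φd = begin
    R x y z                    ≡⟨ translation-invariant y x y z ⟨
    R u (y ⊕ y) d              ≡⟨ replication3-invariant (2 * m) T-involutive T-preserving u (y ⊕ y) d ⟨
    R (T u) (T (y ⊕ y)) (T d)  ≡⟨ cong₂ (λ v w → R v w (T d)) Tu≡u′ (transvection-fixes φ a φ[y⊕y]) ⟩
    R u′ (y ⊕ y) (T d)         ≡⟨ cong (R u′ (y ⊕ y)) (transvection-fixes φ a φd) ⟩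
    R u′ (y ⊕ y) d             ≡⟨ translation-invariant y x′ y z ⟩
    R x′ y z                   ∎
    where
    open ≡-Reasoning
    u  = y ⊕ x
    u′ = y ⊕ x′
    d  = y ⊕ z
    a  = u ⊕ u′
    T  = transvection φ a
    φa : φ a ≡ false
    φa = trans (φ-linear u u′) (cong₂ _xor_ φu φu′)
    φ[y⊕y] : φ (y ⊕ y) ≡ false
    φ[y⊕y] = trans (φ-linear y y) (xor-same (φ y))
    T-involutive : Involutive _≡_ T
    T-involutive = transvection-involutive φ a φ-linear φa
    T-preserving : ZeroSumPreserving (2 * m) T
    T-preserving = additive-involution-zeroSumPreserving (2 * m) (transvection-additive φ a φ-linear) T-involutive
    Tu≡u′ : T u ≡ u′
    Tu≡u′ = trans (transvection-moves φ a φu) (⊕-involutiveˡ u u′)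

replication3-constant : ∀ n m {x y z a b c : Point n} → Distinct x y z → Distinct a b c →
  replication3 n (2 * m) x y z ≡ replication3 n (2 * m) a b c
replication3-constant n m = constant-on-distinct (≡-dec Bool._≟_) (replication3 n (2 * m))
  (replication3-swap₁₂ (2 * m)) (replication3-swap₂₃ (2 * m)) (replication3-replace₁ m)

proposition9 : (n m : ℕ) → 1 ≤ n → 2 < 2 * m → 2 * m < 2 ^ n →
    ∃[ r ] ((x y z : Point n) → x ≢ y → x ≢ z → y ≢ z →
    replication3 n (2 * m) x y z ≡ r)
proposition9 zero          m () _ _
proposition9 (suc zero)    m _ 2<2m 2m<2 = ⊥-elim (<-asym 2<2m 2m<2)
proposition9 (suc (suc n)) m _ _ _ =
  replication3 (2 + n) (2 * m) 𝟎 e₀ e₁ ,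
  λ x y z x≢y x≢z y≢z → replication3-constant (2 + n) m (x≢y , x≢z , y≢z) ((λ ()) , (λ ()) , (λ ()))
  where
  e₀ e₁ : Point (2 + n)
  e₀ = true ∷ 𝟎
  e₁ = false ∷ true ∷ 𝟎
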